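{- Let ${\cal D}$ be a $K$-GDD$_\lambda$ of type $w^u$, and let $k_{\min}=\min\{k: k\in K\}$. Then \[\chi({\cal D})\le\left\lceil\frac{u}{k_{\min}-1}\right\rceil.\] Moreover, if $K=\{k\}$ and $k=u$, then $\chi({\cal D})=2$.
   Context: A $\lambda$-fold group divisible design $K$-GDD$_\lambda$ of type $w^u$ is a triple $(V,{\cal G},{\cal B})$ where ${\cal G}$ partitions the point set $V$ into $u$ groups each of size $w$, ${\cal B}$ is a collection of subsets (blocks) of $V$ with sizes in the set $K$ (all sizes at least $2$), no two points of the same group lie together in a block, and every pair of points from distinct groups lies in exactly $\lambda$ blocks. A weak $c$-colouring is a map from the points to a set of $c$ colours such that no block is monochromatic. The (weak) chromatic number $\chi({\cal D})$ is the least $c$ for which ${\cal D}$ has a weak $c$-colouring. -}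

module Defs where

open import Data.Nat using (ℕ; zero; suc; _+_; _∸_; _≤_)
open import Data.Nat.DivMod using (_/_)
open import Data.Fin using (Fin) renaming (_≟_ to _≟F_)
open import Data.Fin.Subset using (Subset; _∈_; ∣_∣)
open import Data.Fin.Subset.Properties using (_∈?_)
open import Data.List using (List; length; filter; allFin)
open import Data.List.Relation.Unary.All using (All)
import Data.List.Membership.Propositional as LM
open import Data.Product using (_×_)
open import Relation.Nullary using (¬_)
open import Relation.Nullary.Decidable using (_×-dec_)
open import Relation.Binary.PropositionalEquality using (_≡_; _≢_)

-- ⌈ a / b ⌉ for b ≥ 1 (value at b = 0 is an irrelevant convention: 0)
ceilDiv : ℕ → ℕ → ℕ
ceilDiv a zero    = zero
ceilDiv a (suc m) = (a + m) / suc m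

-- Points are Fin n; the groups are the fibres of  group : Fin n → Fin u,
-- each of size w; blocks form a list (multiset) of subsets of the points.
record GDD (K : ℕ → Set) (λ′ w u : ℕ) : Set₁ where
  field
    n          : ℕ
    group      : Fin n → Fin u
    groupSize  : ∀ (i : Fin u) →
                 length (filter (λ x → group x ≟F i) (allFin n)) ≡ w
    blocks     : List (Subset n)
    sizesAtLeast2 : ∀ k → K k → 2 ≤ k
    blockSizeInK  : All (λ b → K ∣ b ∣) blocks
    sameGroupApart : ∀ b → b LM.∈ blocks → ∀ (x y : Fin n) → x ≢ y →
                     x ∈ b → y ∈ b → group x ≢ group y
    pairIndex  : ∀ (x y : Fin n) → group x ≢ group y →
                 length (filter (λ b → (x ∈? b) ×-dec (y ∈? b)) blocks) ≡ λ′

module _ {K : ℕ → Set} {λ′ w u : ℕ} (D : GDD K λ′ w u) where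
  open GDD D

  Monochromatic : ∀ {c} → (Fin n → Fin c) → Subset n → Set
  Monochromatic f b = ∀ (x y : Fin n) → x ∈ b → y ∈ b → f x ≡ f y

  IsWeakColouring : (c : ℕ) → (Fin n → Fin c) → Set
  IsWeakColouring c f = All (λ b → ¬ Monochromatic f b) blocks

  IsChromaticNumber : ℕ → Set
  IsChromaticNumber χ =
    (Data.Product.Σ (Fin n → Fin χ) (IsWeakColouring χ)) ×
    (∀ c → Data.Product.Σ (Fin n → Fin c) (IsWeakColouring c) → χ ≤ c)

-- Split the u groups into ⌈u/(kmin−1)⌉ consecutive bands of at most kmin − 1 groups and colour
-- each point by the band of its group.  A block meets every group at most once and has at least
-- kmin points, so it meets at least two bands and is not monochromatic.  When K = {u} the bound
-- is ⌈u/(u−1)⌉ = 2, and one colour cannot suffice because λ ≥ 1 and w ≥ 1 force a block to exist.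
module Submission where

open import Defs
open import Data.Nat using (ℕ; zero; suc; _+_; _*_; _∸_; _≤_; _<_; z≤n; s≤s; NonZero)
open import Data.Nat.Properties using (≤-reflexive; <-≤-trans; n≮0; n≮n; m<m+n; +-cancelʳ-≤; +-comm; +-monoˡ-≤; module ≤-Reasoning)
open import Data.Nat.DivMod using (_/_; _%_; m%n<n; m≡m%n+[m/n]*n; m<n*o⇒m/o<n)
open import Data.Fin using (Fin; zero; suc; punchOut; toℕ; fromℕ<) renaming (_≟_ to _≟F_)
open import Data.Fin.Properties using (punchOut-injective; suc-injective; fromℕ<-injective; toℕ<n; toℕ-injective)
open import Data.Fin.Subset using (Subset; _∈_; ∣_∣; inside; outside)
open import Data.Fin.Subset.Properties using (_∈?_)
open import Data.Vec using (_∷_; []; here; there)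
open import Data.List using (List; []; _∷_; filter; length; allFin)
open import Data.List.Relation.Unary.All as All using (_∷_)
import Data.List.Membership.Propositional as LM
open import Data.Product using (∃; _×_; _,_; proj₁; proj₂)
open import Data.Empty using (⊥-elim)
open import Relation.Nullary using (yes; no)
open import Relation.Nullary.Decidable using (_×-dec_)
open import Relation.Unary using (Pred; Decidable)
open import Relation.Binary.PropositionalEquality

injectiveOn⇒∣p∣≤m : ∀ {n m} (p : Subset n) (h : ∀ x → x ∈ p → Fin m) →
                    (∀ x y x∈p y∈p → h x x∈p ≡ h y y∈p → x ≡ y) → ∣ p ∣ ≤ m
injectiveOn⇒∣p∣≤m []             h inj = z≤n
injectiveOn⇒∣p∣≤m (outside ∷ p) h inj =
  injectiveOn⇒∣p∣≤m p (λ x x∈p → h (suc x) (there x∈p))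
                      (λ x y x∈p y∈p eq → suc-injective (inj _ _ _ _ eq))
injectiveOn⇒∣p∣≤m {m = zero}  (inside ∷ p) h inj with () ← h zero here
injectiveOn⇒∣p∣≤m {m = suc m} (inside ∷ p) h inj = s≤s (injectiveOn⇒∣p∣≤m p h′ inj′)
  where
  h₀≢h : ∀ x (x∈p : x ∈ p) → h zero here ≢ h (suc x) (there x∈p)
  h₀≢h x x∈p eq with () ← inj _ _ _ _ eq
  h′ : ∀ x → x ∈ p → Fin m
  h′ x x∈p = punchOut (h₀≢h x x∈p)
  inj′ : ∀ x y x∈p y∈p → h′ x x∈p ≡ h′ y y∈p → x ≡ y
  inj′ x y x∈p y∈p eq =
    suc-injective (inj _ _ _ _ (punchOut-injective (h₀≢h x x∈p) (h₀≢h y y∈p) eq))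

filter-nonempty⇒∃ : ∀ {a ℓ} {A : Set a} {P : Pred A ℓ} (P? : Decidable P) (xs : List A) →
                    0 < length (filter P? xs) → ∃ P
filter-nonempty⇒∃ P? (x ∷ xs) 0<len with P? x
... | yes px = x , px
... | no  _  = filter-nonempty⇒∃ P? xs 0<len

/-%-injective : ∀ {a b d} .{{_ : NonZero d}} → a / d ≡ b / d → a % d ≡ b % d → a ≡ b
/-%-injective {a} {b} {d} a/d≡b/d a%d≡b%d = begin
  a                 ≡⟨ m≡m%n+[m/n]*n a d ⟩
  a % d + a / d * d ≡⟨ cong₂ (λ r q → r + q * d) a%d≡b%d a/d≡b/d ⟩
  b % d + b / d * d ≡⟨ m≡m%n+[m/n]*n b d ⟨
  b                 ∎
  where open ≡-Reasoning

m≤ceilDiv[m,n]*n : ∀ m n → m ≤ ceilDiv m (suc n) * suc n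
m≤ceilDiv[m,n]*n m n = +-cancelʳ-≤ n m _ (begin
  m + n                             ≡⟨ m≡m%n+[m/n]*n (m + n) (suc n) ⟩
  (m + n) % suc n + q * suc n       ≤⟨ +-monoˡ-≤ _ (remainder≤n (m%n<n (m + n) (suc n))) ⟩
  n + q * suc n                     ≡⟨ +-comm n _ ⟩
  q * suc n + n                     ∎)
  where
  open ≤-Reasoning
  q = (m + n) / suc n
  remainder≤n : ∀ {r} → r < suc n → r ≤ n
  remainder≤n (s≤s r≤n) = r≤n

module _ {K : ℕ → Set} {λ′ w u : ℕ} (D : GDD K λ′ w u) where
  open GDD D

  group-injectiveOnBlock : ∀ {b} → b LM.∈ blocks → ∀ x y → x ∈ b → y ∈ b →
                           group x ≡ group y → x ≡ y
  group-injectiveOnBlock b∈blocks x y x∈b y∈b gx≡gy with x ≟F y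
  ... | yes x≡y = x≡y
  ... | no  x≢y = ⊥-elim (sameGroupApart _ b∈blocks x y x≢y x∈b y∈b gx≡gy)

  module Bands (m : ℕ) .{{_ : NonZero m}} (c : ℕ) (u≤c*m : u ≤ c * m) where

    bandColouring : Fin n → Fin c
    bandColouring x = fromℕ< (m<n*o⇒m/o<n (<-≤-trans (toℕ<n (group x)) u≤c*m))

    positionInBand : Fin n → Fin m
    positionInBand x = fromℕ< (m%n<n (toℕ (group x)) m)

    monochromatic⇒∣b∣≤m : ∀ {b} → b LM.∈ blocks → Monochromatic D bandColouring b → ∣ b ∣ ≤ m
    monochromatic⇒∣b∣≤m {b} b∈blocks mono =
      injectiveOn⇒∣p∣≤m b (λ x _ → positionInBand x) injective
      where
      injective : ∀ x y → x ∈ b → y ∈ b → positionInBand x ≡ positionInBand y → x ≡ y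
      injective x y x∈b y∈b same-position =
        group-injectiveOnBlock b∈blocks x y x∈b y∈b (toℕ-injective
          (/-%-injective (fromℕ<-injective _ _ _ _ (mono x y x∈b y∈b))
                        (fromℕ<-injective _ _ _ _ same-position)))

    bandColouring-isWeak : (∀ {b} → b LM.∈ blocks → m < ∣ b ∣) →
                           IsWeakColouring D c bandColouring
    bandColouring-isWeak big = All.tabulate λ b∈blocks mono →
      n≮n m (<-≤-trans (big b∈blocks) (monochromatic⇒∣b∣≤m b∈blocks mono))

  groupMember : 1 ≤ w → (i : Fin u) → ∃ λ x → group x ≡ i
  groupMember 1≤w i = filter-nonempty⇒∃ (λ x → group x ≟F i) (allFin n)
                                         (subst (1 ≤_) (sym (groupSize i)) 1≤w)

  blocks≢[] : 1 ≤ λ′ → 1 ≤ w → (i j : Fin u) → i ≢ j → blocks ≢ []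
  blocks≢[] 1≤λ′ 1≤w i j i≢j blocks≡[] = n≮0 (subst (1 ≤_) (sym 0≡λ′) 1≤λ′)
    where
    x = proj₁ (groupMember 1≤w i)
    y = proj₁ (groupMember 1≤w j)
    gx≢gy : group x ≢ group y
    gx≢gy gx≡gy = i≢j (trans (sym (proj₂ (groupMember 1≤w i)))
                             (trans gx≡gy (proj₂ (groupMember 1≤w j))))
    0≡λ′ : 0 ≡ λ′
    0≡λ′ = subst (λ bs → length (filter (λ b → (x ∈? b) ×-dec (y ∈? b)) bs) ≡ λ′)
                 blocks≡[] (pairIndex x y gx≢gy)

  weakColouring⇒2≤c : Fin n → blocks ≢ [] → ∀ {c} (f : Fin n → Fin c) →
                      IsWeakColouring D c f → 2 ≤ c
  weakColouring⇒2≤c x _ {zero} f _ with () ← f x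
  weakColouring⇒2≤c _ nonempty {suc zero} f weak with blocks | weak
  ... | []    | _            = ⊥-elim (nonempty refl)
  ... | _ ∷ _ | not-mono ∷ _ = ⊥-elim (not-mono λ y z _ _ → fin1-unique (f y) (f z))
    where
    fin1-unique : (i j : Fin 1) → i ≡ j
    fin1-unique zero zero = refl
  weakColouring⇒2≤c _ _ {suc (suc c)} _ _ = s≤s (s≤s z≤n)

theorem3p3 :
    ∀ {K : ℕ → Set} {λ′ w u : ℕ} (D : GDD K λ′ w u) →
      (∀ (kmin : ℕ) → K kmin → (∀ k → K k → kmin ≤ k) →
        ∀ (χ : ℕ) → IsChromaticNumber D χ → χ ≤ ceilDiv u (kmin ∸ 1))
      ×
      (∀ (k : ℕ) → (∀ x → K x → x ≡ k) → K k → k ≡ u → 1 ≤ λ′ → 1 ≤ w →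
        IsChromaticNumber D 2)
theorem3p3 {K} {λ′} {w} {u} D = upperBound , uniform
  where
  open GDD D
  upperBound : ∀ kmin → K kmin → (∀ k → K k → kmin ≤ k) →
               ∀ χ → IsChromaticNumber D χ → χ ≤ ceilDiv u (kmin ∸ 1)
  upperBound kmin K-kmin kmin≤ _ (_ , least) with sizesAtLeast2 kmin K-kmin
  ... | s≤s (s≤s {n = m} _) = least _ (_ , bandColouring-isWeak
          (λ b∈blocks → kmin≤ _ (All.lookup blockSizeInK b∈blocks)))
    where open Bands D (suc m) (ceilDiv u (suc m)) (m≤ceilDiv[m,n]*n u m)
  uniform : ∀ k → (∀ x → K x → x ≡ k) → K k → k ≡ u → 1 ≤ λ′ → 1 ≤ w → IsChromaticNumber D 2
  uniform k K⊆k K-k refl 1≤λ′ 1≤w with sizesAtLeast2 k K-k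
  ... | s≤s (s≤s {n = m} _) =
    (_ , bandColouring-isWeak
           (λ b∈blocks → ≤-reflexive (sym (K⊆k _ (All.lookup blockSizeInK b∈blocks)))))
    , λ _ (f , weak) → weakColouring⇒2≤c D x₀ (blocks≢[] D 1≤λ′ 1≤w zero (suc zero) λ ()) f weak
    where
    open Bands D (suc m) 2 (s≤s (m<m+n m (s≤s z≤n)))
    x₀ : Fin n
    x₀ = proj₁ (groupMember D 1≤w zero)
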